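{- Let $\Sigma$ be a finitary algebraic type, $X$ a set, and $FX$ the absolutely free $\Sigma$-algebra (term algebra) over $X$. Let $(A,\equiv_A)$ be a partial subalgebra of $FX$ such that: (1) membership in $A$ is decidable for elements of $FX$; (2) membership in $\equiv_A$ is decidable for pairs of elements of $FX$; (3) there is an algorithm which, given an operation symbol $\sigma$ of arity $n$ and $a_1,\ldots,a_n\in A$, determines whether there exist $b_1,\ldots,b_n\in A$ with $a_i\equiv_A b_i$ for $1\le i\le n$ and $\sigma(b_1,\ldots,b_n)\in A$. Then the congruence $\equiv$ on $FX$ generated by $\equiv_A$ is decidable. Moreover, the decision procedure for $\equiv$ is obtained uniformly from the algorithms deciding (1), (2) and (3).
   Context: Terms of $FX$ are regarded as finite syntactic objects, handled effectively in the usual way. A partial subalgebra is a pair $(A,\equiv_A)$ where $A\subseteq FX$ is closed under taking subterms and $\equiv_A$ is an equivalence relation on $A$ which is a partial congruence: for every operation symbol $\sigma$ of arity $n$, if $a_i\equiv_A b_i$ for $1\le i\le n$ and both $\sigma(a_1,\ldots,a_n)$ and $\sigma(b_1,\ldots,b_n)$ belong to $A$, then $\sigma(a_1,\ldots,a_n)\equiv_A\sigma(b_1,\ldots,b_n)$. -}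

module Defs where

open import Data.Nat using (ℕ)
open import Data.Fin using (Fin)
open import Data.Vec using (Vec; lookup)
open import Data.Product using (Σ; _×_; ∃)
open import Relation.Nullary using (Dec)

record Signature : Set₁ where
  field
    Op    : Set
    arity : Op → ℕ
open Signature public

data Term (S : Signature) (X : Set) : Set where
  var : X → Term S X
  op  : (σ : Op S) → Vec (Term S X) (arity S σ) → Term S X

module _ {S : Signature} {X : Set} where

  record IsPartialSubalgebra (A : Term S X → Set) (_≡A_ : Term S X → Term S X → Set) : Set where
    field
      subterm-closed : ∀ σ (ts : Vec (Term S X) (arity S σ)) → A (op σ ts) →
                       ∀ i → A (lookup ts i)
      dom   : ∀ {a b} → a ≡A b → A a × A b
      refl  : ∀ {a} → A a → a ≡A a
      sym   : ∀ {a b} → a ≡A b → b ≡A a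
      trans : ∀ {a b c} → a ≡A b → b ≡A c → a ≡A c
      pcong : ∀ σ (as bs : Vec (Term S X) (arity S σ)) →
              (∀ i → lookup as i ≡A lookup bs i) →
              A (op σ as) → A (op σ bs) → op σ as ≡A op σ bs

  data Generated (R : Term S X → Term S X → Set) : Term S X → Term S X → Set where
    base  : ∀ {s t} → R s t → Generated R s t
    refl  : ∀ {s} → Generated R s s
    sym   : ∀ {s t} → Generated R s t → Generated R t s
    trans : ∀ {s t u} → Generated R s t → Generated R t u → Generated R s u
    cong  : ∀ σ (ts us : Vec (Term S X) (arity S σ)) →
            (∀ i → Generated R (lookup ts i) (lookup us i)) →
            Generated R (op σ ts) (op σ us)

  ExtensionProblem : (A : Term S X → Set) (_≡A_ : Term S X → Term S X → Set) →
                     (σ : Op S) → Vec (Term S X) (arity S σ) → Set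
  ExtensionProblem A _≡A_ σ as =
    Σ (Vec (Term S X) (arity S σ)) λ bs →
      (∀ i → A (lookup bs i) × (lookup as i ≡A lookup bs i)) × A (op σ bs)

-- Normalise bottom-up: a variable in A becomes its ≡A-class, and a node σ(t₁,…,tₙ)
-- whose normalised arguments are classes [a₁],…,[aₙ] collapses to the class of
-- σ(b₁,…,bₙ) if some bᵢ ≡A aᵢ with σ(b₁,…,bₙ) ∈ A exist, which hypothesis (3) decides;
-- otherwise it stays a free node. Normal forms are compared up to ≡A on classes, which
-- is decidable by (2). Every normalisation step is an instance of ≡, so this is sound.
-- It is complete because collapsing depends only on the classes of the arguments
-- (different choices of the bᵢ give ≡A-related results by partial congruence), and by
-- subterm closure a term of A normalises to its own class.
module Submission where

open import Defs
open import Data.Vec using (Vec; lookup; []; _∷_)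
open import Data.Fin using (zero; suc)
open import Data.Product using (_,_; proj₁; proj₂)
open import Data.Empty using (⊥-elim)
open import Function using (_∘_; case_of_)
open import Relation.Nullary using (Dec; yes; no)
open import Relation.Nullary.Decidable using (map′)
open import Relation.Binary.Definitions using (DecidableEquality)
open import Relation.Binary.PropositionalEquality as ≡ using (_≡_; subst; subst₂)

module NormalForms {S : Signature} {X : Set}
  (A : Term S X → Set) (_≡A_ : Term S X → Term S X → Set) where

  FX : Set
  FX = Term S X

  data NF : Set where
    class : (a : FX) → A a → NF
    fvar  : X → NF
    fop   : (σ : Op S) → Vec NF (arity S σ) → NF

  data _≈_ : NF → NF → Set where
    class≈ : ∀ {a b p q} → a ≡A b → class a p ≈ class b q
    fvar≈  : ∀ {x} → fvar x ≈ fvar x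
    fop≈   : ∀ {σ ns ms} → (∀ i → lookup ns i ≈ lookup ms i) → fop σ ns ≈ fop σ ms

  class≈-inv : ∀ {a b p q} → class a p ≈ class b q → a ≡A b
  class≈-inv (class≈ r) = r

  mutual
    ⟦_⟧ : NF → FX
    ⟦ class a _ ⟧ = a
    ⟦ fvar x ⟧    = var x
    ⟦ fop σ ns ⟧  = op σ ⟦ ns ⟧*

    ⟦_⟧* : ∀ {k} → Vec NF k → Vec FX k
    ⟦ [] ⟧*     = []
    ⟦ n ∷ ns ⟧* = ⟦ n ⟧ ∷ ⟦ ns ⟧*

  lookup-⟦⟧* : ∀ {k} (ns : Vec NF k) i → lookup ⟦ ns ⟧* i ≡ ⟦ lookup ns i ⟧
  lookup-⟦⟧* (n ∷ ns) zero    = ≡.refl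
  lookup-⟦⟧* (n ∷ ns) (suc i) = lookup-⟦⟧* ns i

  ≈-sound : ∀ {n m} → n ≈ m → Generated _≡A_ ⟦ n ⟧ ⟦ m ⟧
  ≈-sound (class≈ r) = base r
  ≈-sound fvar≈      = refl
  ≈-sound (fop≈ {σ} {ns} {ms} h) =
    cong σ ⟦ ns ⟧* ⟦ ms ⟧* λ i →
      subst₂ (Generated _≡A_) (≡.sym (lookup-⟦⟧* ns i)) (≡.sym (lookup-⟦⟧* ms i)) (≈-sound (h i))

  module Decision (_≟O_ : DecidableEquality (Op S)) (_≟X_ : DecidableEquality X)
                  (_≟A_ : (s t : FX) → Dec (s ≡A t)) where

    mutual
      _≈?_ : (n m : NF) → Dec (n ≈ m)
      class a _ ≈? class b _ = map′ class≈ class≈-inv (a ≟A b)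
      fvar x ≈? fvar y with x ≟X y
      ... | yes ≡.refl = yes fvar≈
      ... | no x≢y     = no λ { fvar≈ → x≢y ≡.refl }
      fop σ ns ≈? fop τ ms with σ ≟O τ
      ... | no σ≢τ     = no λ { (fop≈ _) → σ≢τ ≡.refl }
      ... | yes ≡.refl = map′ fop≈ (λ { (fop≈ h) → h }) (ns ≈*? ms)
      class _ _ ≈? fvar _    = no λ ()
      class _ _ ≈? fop _ _   = no λ ()
      fvar _    ≈? class _ _ = no λ ()
      fvar _    ≈? fop _ _   = no λ ()
      fop _ _   ≈? class _ _ = no λ ()
      fop _ _   ≈? fvar _    = no λ ()

      _≈*?_ : ∀ {k} (ns ms : Vec NF k) → Dec (∀ i → lookup ns i ≈ lookup ms i)
      [] ≈*? [] = yes λ ()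
      (n ∷ ns) ≈*? (m ∷ ms) with n ≈? m | ns ≈*? ms
      ... | yes n≈m | yes h = yes λ { zero → n≈m ; (suc i) → h i }
      ... | no n≉m  | _     = no λ h → n≉m (h zero)
      ... | yes _   | no ¬h = no λ h → ¬h (h ∘ suc)

  module _ (ips : IsPartialSubalgebra A _≡A_) where

    open IsPartialSubalgebra ips
      renaming (refl to ≡A-refl; sym to ≡A-sym; trans to ≡A-trans)

    mutual
      ≈-refl : ∀ n → n ≈ n
      ≈-refl (class a p) = class≈ (≡A-refl p)
      ≈-refl (fvar x)    = fvar≈
      ≈-refl (fop σ ns)  = fop≈ (≈*-refl ns)

      ≈*-refl : ∀ {k} (ns : Vec NF k) i → lookup ns i ≈ lookup ns i
      ≈*-refl (n ∷ ns) zero    = ≈-refl n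
      ≈*-refl (n ∷ ns) (suc i) = ≈*-refl ns i

    ≈-sym : ∀ {n m} → n ≈ m → m ≈ n
    ≈-sym (class≈ r) = class≈ (≡A-sym r)
    ≈-sym fvar≈      = fvar≈
    ≈-sym (fop≈ h)   = fop≈ (≈-sym ∘ h)

    ≈-trans : ∀ {n m l} → n ≈ m → m ≈ l → n ≈ l
    ≈-trans (class≈ r) (class≈ r′) = class≈ (≡A-trans r r′)
    ≈-trans fvar≈      fvar≈       = fvar≈
    ≈-trans (fop≈ h)   (fop≈ h′)   = fop≈ λ i → ≈-trans (h i) (h′ i)

    record Classes {k} (ns : Vec NF k) : Set where
      constructor classes
      field
        reps   : Vec FX k
        reps∈A : ∀ i → A (lookup reps i)
        ≈reps  : ∀ i → lookup ns i ≈ class (lookup reps i) (reps∈A i)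

    Classes-resp : ∀ {k} {ns ms : Vec NF k} → (∀ i → lookup ns i ≈ lookup ms i) →
                   Classes ns → Classes ms
    Classes-resp h (classes bs pb e) = classes bs pb λ i → ≈-trans (≈-sym (h i)) (e i)

    classes? : ∀ {k} (ns : Vec NF k) → Dec (Classes ns)
    classes? [] = yes (classes [] (λ ()) λ ())
    classes? (class a p ∷ ns) with classes? ns
    ... | yes (classes bs pb e) =
          yes (classes (a ∷ bs) (λ { zero → p ; (suc i) → pb i })
                                λ { zero → ≈-refl (class a p) ; (suc i) → e i })
    ... | no ¬c = no λ { (classes (_ ∷ bs) pb e) → ¬c (classes bs (pb ∘ suc) (e ∘ suc)) }
    classes? (fvar _ ∷ _)  = no λ { (classes _ _ e) → case e zero of λ () }
    classes? (fop _ _ ∷ _) = no λ { (classes _ _ e) → case e zero of λ () }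

    record Collapsible (σ : Op S) (ns : Vec NF (arity S σ)) : Set where
      constructor collapsible
      field
        args : Classes ns
        op∈A : A (op σ (Classes.reps args))

    collapse : ∀ {σ ns} → Collapsible σ ns → NF
    collapse {σ} (collapsible (classes bs _ _) q) = class (op σ bs) q

    collapse-unique : ∀ {σ ns} (c c′ : Collapsible σ ns) → collapse c ≈ collapse c′
    collapse-unique {σ} (collapsible (classes bs _ e) p) (collapsible (classes cs _ e′) q) =
      class≈ (pcong σ bs cs (λ i → class≈-inv (≈-trans (≈-sym (e i)) (e′ i))) p q)

    module Collapsing
      (ext : (σ : Op S) (as : Vec FX (arity S σ)) → (∀ i → A (lookup as i)) →
             Dec (ExtensionProblem A _≡A_ σ as)) where

      -- Once the arguments are classes [aᵢ], collapsibility is exactly the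
      -- extension problem for the aᵢ.
      collapsible? : ∀ σ (ns : Vec NF (arity S σ)) → Dec (Collapsible σ ns)
      collapsible? σ ns with classes? ns
      ... | no ¬c = no (¬c ∘ Collapsible.args)
      ... | yes (classes as pa e) with ext σ as pa
      ...   | yes (bs , h , q) =
              yes (collapsible (classes bs (proj₁ ∘ h) λ i →
                                  ≈-trans (e i) (class≈ (proj₂ (h i)))) q)
      ...   | no ¬x = no λ { (collapsible (classes bs pb e′) q) →
                ¬x (bs , (λ i → pb i , class≈-inv (≈-trans (≈-sym (e i)) (e′ i))) , q) }

      combine : (σ : Op S) → Vec NF (arity S σ) → NF
      combine σ ns with collapsible? σ ns
      ... | yes c = collapse c
      ... | no _  = fop σ ns

      combine-collapse : ∀ {σ ns} (c : Collapsible σ ns) → combine σ ns ≈ collapse c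
      combine-collapse {σ} {ns} c with collapsible? σ ns
      ... | yes c′ = collapse-unique c′ c
      ... | no ¬c  = ⊥-elim (¬c c)

      combine-cong : ∀ σ {ns ms} → (∀ i → lookup ns i ≈ lookup ms i) →
                     combine σ ns ≈ combine σ ms
      combine-cong σ {ns} {ms} h with collapsible? σ ns | collapsible? σ ms
      ... | yes (collapsible c p) | yes c′ = collapse-unique (collapsible (Classes-resp h c) p) c′
      ... | yes (collapsible c p) | no ¬c′ = ⊥-elim (¬c′ (collapsible (Classes-resp h c) p))
      ... | no ¬c | yes (collapsible c′ q) =
            ⊥-elim (¬c (collapsible (Classes-resp (≈-sym ∘ h) c′) q))
      ... | no _  | no _                   = fop≈ h

      combine-sound : ∀ σ (ts : Vec FX (arity S σ)) (ns : Vec NF (arity S σ)) →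
                      (∀ i → Generated _≡A_ (lookup ts i) ⟦ lookup ns i ⟧) →
                      Generated _≡A_ (op σ ts) ⟦ combine σ ns ⟧
      combine-sound σ ts ns h with collapsible? σ ns
      ... | yes (collapsible (classes bs _ e) _) = cong σ ts bs λ i → trans (h i) (≈-sound (e i))
      ... | no _ = cong σ ts ⟦ ns ⟧* λ i →
        subst (Generated _≡A_ (lookup ts i)) (≡.sym (lookup-⟦⟧* ns i)) (h i)

      module Normalising (A? : (t : FX) → Dec (A t)) where

        -- Membership of op σ ts in A is never tested: by subterm closure the
        -- collapsing step detects it (norm-class).
        mutual
          norm : FX → NF
          norm (var x) with A? (var x)
          ... | yes p = class (var x) p
          ... | no _  = fvar x
          norm (op σ ts) = combine σ (norm* ts)

          norm* : ∀ {k} → Vec FX k → Vec NF k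
          norm* []       = []
          norm* (t ∷ ts) = norm t ∷ norm* ts

        lookup-norm* : ∀ {k} (ts : Vec FX k) i → lookup (norm* ts) i ≡ norm (lookup ts i)
        lookup-norm* (t ∷ ts) zero    = ≡.refl
        lookup-norm* (t ∷ ts) (suc i) = lookup-norm* ts i

        mutual
          norm-sound : ∀ t → Generated _≡A_ t ⟦ norm t ⟧
          norm-sound (var x) with A? (var x)
          ... | yes _ = refl
          ... | no _  = refl
          norm-sound (op σ ts) = combine-sound σ ts (norm* ts) (norm*-sound ts)

          norm*-sound : ∀ {k} (ts : Vec FX k) i →
                        Generated _≡A_ (lookup ts i) ⟦ lookup (norm* ts) i ⟧
          norm*-sound (t ∷ ts) zero    = norm-sound t
          norm*-sound (t ∷ ts) (suc i) = norm*-sound ts i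

        mutual
          norm-class : ∀ t (p : A t) → norm t ≈ class t p
          norm-class (var x) p with A? (var x)
          ... | yes p′ = class≈ (≡A-refl p′)
          ... | no ¬p  = ⊥-elim (¬p p)
          norm-class (op σ ts) p =
            combine-collapse (collapsible (classes ts ps (norm*-class ts ps)) p)
            where ps = subterm-closed σ ts p

          norm*-class : ∀ {k} (ts : Vec FX k) (ps : ∀ i → A (lookup ts i)) →
                        ∀ i → lookup (norm* ts) i ≈ class (lookup ts i) (ps i)
          norm*-class (t ∷ ts) ps zero    = norm-class t (ps zero)
          norm*-class (t ∷ ts) ps (suc i) = norm*-class ts (ps ∘ suc) i

        norm-complete : ∀ {s t} → Generated _≡A_ s t → norm s ≈ norm t
        norm-complete (base r) =
          ≈-trans (norm-class _ (proj₁ (dom r)))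
                  (≈-trans (class≈ r) (≈-sym (norm-class _ (proj₂ (dom r)))))
        norm-complete refl        = ≈-refl _
        norm-complete (sym g)     = ≈-sym (norm-complete g)
        norm-complete (trans g h) = ≈-trans (norm-complete g) (norm-complete h)
        norm-complete (cong σ ts us h) = combine-cong σ λ i →
          subst₂ _≈_ (≡.sym (lookup-norm* ts i)) (≡.sym (lookup-norm* us i)) (norm-complete (h i))

proposition1p1 : (S : Signature) (X : Set) →
    DecidableEquality (Op S) → DecidableEquality X →
    (A : Term S X → Set) (_≡A_ : Term S X → Term S X → Set) →
    IsPartialSubalgebra A _≡A_ →
    ((t : Term S X) → Dec (A t)) →
    ((s t : Term S X) → Dec (s ≡A t)) →
    ((σ : Op S) (as : Vec (Term S X) (arity S σ)) → (∀ i → A (lookup as i)) →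
    Dec (ExtensionProblem A _≡A_ σ as)) →
    (s t : Term S X) → Dec (Generated _≡A_ s t)
proposition1p1 S X _≟O_ _≟X_ A _≡A_ ips A? _≟A_ ext s t =
  map′ (λ e → trans (norm-sound s) (trans (≈-sound e) (sym (norm-sound t))))
       norm-complete
       (norm s ≈? norm t)
  where
    open NormalForms A _≡A_
    open Decision _≟O_ _≟X_ _≟A_
    open Collapsing ips ext
    open Normalising A?
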